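{- Let $p,q,a,b$ be complex numbers with $p\neq0$, $q\neq0$, and let $(u_j)$, $(w_j)$ ($j\in\mathbb{Z}$) be as in the context. Let $r,s,m,n$ be integers and $k\ge0$ an integer such that all the denominators below are nonzero. Then \[ -q^{r-s}u_{m-r}w_nw_{n-(m-r)(k+1)}\sum_{j=0}^k\frac{u_{r-s}^{k-j}u_{m-s}^j w_{n-m+s-(m-r)k+(m-r)j}}{w_{n-(m-r)k+(m-r)j}\,w_{n-(m-r)-(m-r)k+(m-r)j}} = u_{r-s}^{k+1}w_n - u_{m-s}^{k+1}w_{n-(m-r)(k+1)}, \] \[ u_{m-s}w_nw_{n-(m-s)(k+1)}\sum_{j=0}^k\frac{(-1)^jq^{(r-s)j}u_{r-s}^{k-j}u_{m-r}^j w_{n-(m-r)-(m-s)k+(m-s)j}}{w_{n-(m-s)k+(m-s)j}\,w_{n-(m-s)-(m-s)k+(m-s)j}} = u_{r-s}^{k+1}w_n - (-1)^{k+1}q^{(r-s)(k+1)}u_{m-r}^{k+1}w_{n-(m-s)(k+1)}, \] \[ u_{r-s}w_nw_{n-(r-s)(k+1)}\sum_{j=0}^k\frac{q^{(r-s)j}u_{m-s}^{k-j}u_{m-r}^j w_{n+m-r-(r-s)k+(r-s)j}}{w_{n-(r-s)k+(r-s)j}\,w_{n-(r-s)-(r-s)k+(r-s)j}} = u_{m-s}^{k+1}w_n - q^{(r-s)(k+1)}u_{m-r}^{k+1}w_{n-(r-s)(k+1)}, \] \[ -q^{r-s}u_{m+s}w_nw_{n-(m+s)(k+1)}\sum_{j=0}^k\frac{u_{r-s}^{k-j}u_{m+r}^j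 w_{n-m-r-(m+s)k+(m+s)j}}{w_{n-(m+s)k+(m+s)j}\,w_{n-(m+s)-(m+s)k+(m+s)j}} = u_{r-s}^{k+1}w_n - u_{m+r}^{k+1}w_{n-(m+s)(k+1)}, \] \[ u_{m+r}w_nw_{n-(m+r)(k+1)}\sum_{j=0}^k\frac{(-1)^jq^{(r-s)j}u_{r-s}^{k-j}u_{m+s}^j w_{n-(m+s)-(m+r)k+(m+r)j}}{w_{n-(m+r)k+(m+r)j}\,w_{n-(m+r)-(m+r)k+(m+r)j}} = u_{r-s}^{k+1}w_n - (-1)^{k+1}q^{(r-s)(k+1)}u_{m+s}^{k+1}w_{n-(m+r)(k+1)}, \] \[ u_{r-s}w_nw_{n-(r-s)(k+1)}\sum_{j=0}^k\frac{q^{(r-s)j}u_{m+r}^{k-j}u_{m+s}^j w_{n+m+s-(r-s)k+(r-s)j}}{w_{n-(r-s)k+(r-s)j}\,w_{n-(r-s)-(r-s)k+(r-s)j}} = u_{m+r}^{k+1}w_n - q^{(r-s)(k+1)}u_{m+s}^{k+1}w_{n-(r-s)(k+1)}. \]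
   Context: The Horadam sequence $(w_j)=(w_j(a,b;p,q))$ is defined by $w_0=a$, $w_1=b$, and $w_j=pw_{j-1}-qw_{j-2}$ for all integers $j$ (extended to negative indices via $w_{j-2}=(pw_{j-1}-w_j)/q$). The Lucas sequence of the first kind is $u_j=w_j(0,1;p,q)$, i.e. $u_0=0,u_1=1$ with the same recurrence. Negative powers of $q$ are allowed. -}

module Defs where

open import Level using (Level; _⊔_) renaming (suc to lsuc)
open import Algebra.Bundles using (CommutativeRing)
open import Data.Nat as ℕ using (ℕ; zero; suc)
open import Data.Integer as ℤ using (ℤ; +_; -[1+_])
open import Data.Product using (_×_; _,_; proj₁)
open import Relation.Nullary using (¬_)

-- A field: a commutative ring with 0 ≠ 1 and a (total) inverse function
-- that is a genuine multiplicative inverse on every nonzero element.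
-- (The stdlib has no Field bundle.)
record Field (c ℓ : Level) : Set (lsuc (c ⊔ ℓ)) where
  field
    commutativeRing : CommutativeRing c ℓ
  open CommutativeRing commutativeRing public
  infix 8 _⁻¹
  field
    _⁻¹       : Carrier → Carrier
    ⁻¹-inverse : ∀ x → ¬ (x ≈ 0#) → x * (x ⁻¹) ≈ 1#
    0#≉1#     : ¬ (0# ≈ 1#)

module Horadam {c ℓ : Level} (F : Field c ℓ) where
  open Field F

  infixl 7 _/_
  _/_ : Carrier → Carrier → Carrier
  x / y = x * (y ⁻¹)

  pow : Carrier → ℕ → Carrier
  pow x zero    = 1#
  pow x (suc n) = x * pow x n

  zpow : Carrier → ℤ → Carrier
  zpow x (+ n)      = pow x n
  zpow x -[1+ n ]   = pow (x ⁻¹) (suc n)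

  sumTo : ℕ → (ℕ → Carrier) → Carrier
  sumTo zero    f = f 0
  sumTo (suc k) f = sumTo k f + f (suc k)

  -- (w_n , w_{n+1}) for n ≥ 0
  wPos : (p q a b : Carrier) → ℕ → Carrier × Carrier
  wPos p q a b zero = a , b
  wPos p q a b (suc n) with wPos p q a b n
  ... | x , y = y , (p * y - q * x)

  -- (w_{-n} , w_{-n+1}) for n ≥ 0, via w_{j-2} = (p w_{j-1} - w_j)/q
  wNeg : (p q a b : Carrier) → ℕ → Carrier × Carrier
  wNeg p q a b zero = a , b
  wNeg p q a b (suc n) with wNeg p q a b n
  ... | x , y = ((p * x - y) / q) , x

  w : (p q a b : Carrier) → ℤ → Carrier
  w p q a b (+ n)    = proj₁ (wPos p q a b n)
  w p q a b -[1+ n ] = proj₁ (wNeg p q a b (suc n))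

  u : (p q : Carrier) → ℤ → Carrier
  u p q = w p q 0# 1#

module Submission where

-- All six are instances of one mechanism.  For any two indices α, β and any K,
--   (★)  u_α w_{β+K} − u_β w_{α+K} = −q^α u_{β−α} w_K ,
-- proved by observing that both sides solve the Horadam recurrence in β − α
-- and agree at β − α = 0, 1; the value at 1 is the Casoratian of u and the
-- shifted w, which gets multiplied by q at every step and hence equals q^α w_K.
-- Dividing (★) by the two w-factors turns it into a difference of reciprocals,
--   c·w_X / (w_{N} w_{M}) = A / w_M − B / w_N ,
-- and a sum Σ_j A^{k−j} B^j (A h_j − B h_{j+1}) telescopes to
-- A^{k+1} h_0 − B^{k+1} h_{k+1}.  Three "shapes" (which two of the three
-- u-factors of (★) play the roles of A and B) give identities (1,4), (2,5)
-- and (3,6) of the theorem, which then follow by integer index bookkeeping.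

open import Defs
open import Level using (Level)
open import Data.Nat as ℕ using (ℕ; zero; suc; _≤_; _∸_)
open import Data.Integer as ℤ using (ℤ; +_)
open import Data.Product using (_×_)
open import Relation.Nullary using (¬_)

open import Algebra.Bundles using (CommutativeRing)
open import Algebra.Solver.Ring.AlmostCommutativeRing
  using (fromCommutativeRing; _-Raw-AlmostCommutative⟶_)
open import Data.Integer using (-[1+_])
import Data.Integer.Properties as ℤP
open import Data.Integer.Tactic.RingSolver using (solve-∀)
import Data.Nat.Properties as ℕP
open import Data.Maybe using (Maybe; just; nothing)
open import Data.Product using (_,_; proj₁; proj₂)
open import Data.Sign as Sign using (Sign)
open import Relation.Binary.PropositionalEquality as P using (_≡_)
open import Relation.Nullary using (yes; no)

-- The canonical map ℤ → R, n ↦ n·1, is a ring homomorphism; with it the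
-- standard ring solver normalises expressions over R with integer
-- coefficients (whose equality is decidable, so cancellations are found).
module ℤ-Coefficients {c ℓ : Level} (R : CommutativeRing c ℓ) where
  open CommutativeRing R
  open import Algebra.Properties.Semiring.Mult.TCOptimised semiring
    using (×-homo-+; ×1-homo-*) renaming (_×_ to _×ₙ_)
  open import Algebra.Properties.AbelianGroup +-abelianGroup using (⁻¹-∙-comm)
  open import Algebra.Properties.Group +-group using (⁻¹-involutive; ε⁻¹≈ε)
  open import Algebra.Properties.Ring ring using (-1*x≈-x)
  open import Algebra.Properties.CommutativeSemigroup +-commutativeSemigroup
    using () renaming (interchange to +-interchange)
  open import Algebra.Properties.CommutativeSemigroup *-commutativeSemigroup
    using () renaming (interchange to *-interchange)
  open import Relation.Binary.Reasoning.Setoid setoid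

  fromℕ : ℕ → Carrier
  fromℕ n = n ×ₙ 1#

  fromℤ : ℤ → Carrier
  fromℤ (+ n)      = fromℕ n
  fromℤ -[1+ n ]   = - fromℕ (suc n)

  fromSign : Sign → Carrier
  fromSign Sign.+ = 1#
  fromSign Sign.- = - 1#

  fromℤ-‿homo : ∀ i → fromℤ (ℤ.- i) ≈ - fromℤ i
  fromℤ-‿homo (+ zero)  = sym ε⁻¹≈ε
  fromℤ-‿homo (+ suc n) = refl
  fromℤ-‿homo -[1+ n ]  = sym (⁻¹-involutive _)

  fromℤ-⊖ : ∀ m n → fromℤ (m ℤ.⊖ n) ≈ fromℕ m - fromℕ n
  fromℤ-⊖ m       zero    = sym (trans (+-congˡ ε⁻¹≈ε) (+-identityʳ _))
  fromℤ-⊖ zero    (suc n) = sym (+-identityˡ _)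
  fromℤ-⊖ (suc m) (suc n) = begin
    fromℤ (suc m ℤ.⊖ suc n)           ≡⟨ P.cong fromℤ (ℤP.[1+m]⊖[1+n]≡m⊖n m n) ⟩
    fromℤ (m ℤ.⊖ n)                   ≈⟨ fromℤ-⊖ m n ⟩
    fromℕ m - fromℕ n                 ≈⟨ cancel ⟨
    (1# + fromℕ m) - (1# + fromℕ n)   ≈⟨ +-cong (×-homo-+ 1# 1 m) (-‿cong (×-homo-+ 1# 1 n)) ⟨
    fromℕ (suc m) - fromℕ (suc n)     ∎
    where
    cancel : (1# + fromℕ m) - (1# + fromℕ n) ≈ fromℕ m - fromℕ n
    cancel = begin
      (1# + fromℕ m) + - (1# + fromℕ n)    ≈⟨ +-congˡ (⁻¹-∙-comm 1# (fromℕ n)) ⟨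
      (1# + fromℕ m) + (- 1# + - fromℕ n)  ≈⟨ +-interchange 1# (fromℕ m) (- 1#) (- fromℕ n) ⟩
      (1# - 1#) + (fromℕ m - fromℕ n)      ≈⟨ +-congʳ (-‿inverseʳ 1#) ⟩
      0# + (fromℕ m - fromℕ n)             ≈⟨ +-identityˡ _ ⟩
      fromℕ m - fromℕ n                    ∎

  fromℤ-+-homo : ∀ i j → fromℤ (i ℤ.+ j) ≈ fromℤ i + fromℤ j
  fromℤ-+-homo (+ m)    (+ n)    = ×-homo-+ 1# m n
  fromℤ-+-homo (+ m)    -[1+ n ] = fromℤ-⊖ m (suc n)
  fromℤ-+-homo -[1+ m ] (+ n)    = trans (fromℤ-⊖ n (suc m)) (+-comm _ _)
  fromℤ-+-homo -[1+ m ] -[1+ n ] = begin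
    - fromℕ (suc (suc (m ℕ.+ n)))          ≡⟨ P.cong (λ z → - fromℕ (suc z)) (P.sym (ℕP.+-suc m n)) ⟩
    - fromℕ (suc m ℕ.+ suc n)              ≈⟨ -‿cong (×-homo-+ 1# (suc m) (suc n)) ⟩
    - (fromℕ (suc m) + fromℕ (suc n))      ≈⟨ ⁻¹-∙-comm _ _ ⟨
    - fromℕ (suc m) + - fromℕ (suc n)      ∎

  fromℤ-◃ : ∀ s n → fromℤ (s ℤ.◃ n) ≈ fromSign s * fromℕ n
  fromℤ-◃ s       zero    = sym (zeroʳ _)
  fromℤ-◃ Sign.+ (suc n) = sym (*-identityˡ _)
  fromℤ-◃ Sign.- (suc n) = sym (-1*x≈-x _)

  fromSign-*-homo : ∀ s t → fromSign (s Sign.* t) ≈ fromSign s * fromSign t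
  fromSign-*-homo Sign.+ Sign.+ = sym (*-identityˡ _)
  fromSign-*-homo Sign.+ Sign.- = sym (*-identityˡ _)
  fromSign-*-homo Sign.- Sign.+ = sym (*-identityʳ _)
  fromSign-*-homo Sign.- Sign.- = sym (trans (-1*x≈-x _) (⁻¹-involutive _))

  fromℤ-sign-abs : ∀ i → fromℤ i ≈ fromSign (ℤ.sign i) * fromℕ ℤ.∣ i ∣
  fromℤ-sign-abs i =
    trans (reflexive (P.cong fromℤ (P.sym (ℤP.◃-inverse i)))) (fromℤ-◃ (ℤ.sign i) ℤ.∣ i ∣)

  fromℤ-*-homo : ∀ i j → fromℤ (i ℤ.* j) ≈ fromℤ i * fromℤ j
  fromℤ-*-homo i j = begin
    fromℤ (i ℤ.* j)
      ≈⟨ fromℤ-◃ (ℤ.sign i Sign.* ℤ.sign j) (ℤ.∣ i ∣ ℕ.* ℤ.∣ j ∣) ⟩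
    fromSign (ℤ.sign i Sign.* ℤ.sign j) * fromℕ (ℤ.∣ i ∣ ℕ.* ℤ.∣ j ∣)
      ≈⟨ *-cong (fromSign-*-homo (ℤ.sign i) (ℤ.sign j)) (×1-homo-* ℤ.∣ i ∣ ℤ.∣ j ∣) ⟩
    (fromSign (ℤ.sign i) * fromSign (ℤ.sign j)) * (fromℕ ℤ.∣ i ∣ * fromℕ ℤ.∣ j ∣)
      ≈⟨ *-interchange _ _ _ _ ⟩
    (fromSign (ℤ.sign i) * fromℕ ℤ.∣ i ∣) * (fromSign (ℤ.sign j) * fromℕ ℤ.∣ j ∣)
      ≈⟨ *-cong (fromℤ-sign-abs i) (fromℤ-sign-abs j) ⟨
    fromℤ i * fromℤ j ∎

  fromℤ-homomorphism : ℤ.+-*-rawRing -Raw-AlmostCommutative⟶ fromCommutativeRing R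
  fromℤ-homomorphism = record
    { ⟦_⟧ = fromℤ ; +-homo = fromℤ-+-homo ; *-homo = fromℤ-*-homo ; -‿homo = fromℤ-‿homo
    ; 0-homo = refl ; 1-homo = refl }

  coefficient-equality : ∀ i j → Maybe (fromℤ i ≈ fromℤ j)
  coefficient-equality i j with i ℤ.≟ j
  ... | yes i≡j = just (reflexive (P.cong fromℤ i≡j))
  ... | no _    = nothing

  open import Algebra.Solver.Ring ℤ.+-*-rawRing (fromCommutativeRing R) fromℤ-homomorphism coefficient-equality
    public using (solve; _:=_; _:+_; _:*_; _:-_; :-_; con)

ℤ-bi-induction : ∀ {ℓ} (Q : ℤ → Set ℓ) → Q (+ 0) →
                 (∀ i → Q i → Q (ℤ.suc i)) → (∀ i → Q (ℤ.suc i) → Q i) → ∀ i → Q i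
ℤ-bi-induction Q base up down (+ zero)        = base
ℤ-bi-induction Q base up down (+ suc n)       = up (+ n) (ℤ-bi-induction Q base up down (+ n))
ℤ-bi-induction Q base up down -[1+ zero ]     = down -[1+ zero ] base
ℤ-bi-induction Q base up down -[1+ suc n ]    = down -[1+ suc n ] (ℤ-bi-induction Q base up down -[1+ n ])

module FieldProperties {c ℓ : Level} (F : Field c ℓ) where
  open Field F
  open Horadam F using (_/_)
  open ℤ-Coefficients commutativeRing using (solve; _:=_; _:*_; _:-_)
  open import Relation.Binary.Reasoning.Setoid setoid

  *-cancelˡ : ∀ {z x y} → ¬ (z ≈ 0#) → z * x ≈ z * y → x ≈ y
  *-cancelˡ {z} {x} {y} z≉0 zx≈zy = begin
    x                  ≈⟨ *-identityˡ x ⟨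
    1# * x             ≈⟨ *-congʳ (⁻¹-inverse z z≉0) ⟨
    (z * z ⁻¹) * x     ≈⟨ solve 3 (λ z z' x → (z :* z') :* x := z' :* (z :* x)) refl z (z ⁻¹) x ⟩
    z ⁻¹ * (z * x)     ≈⟨ *-congˡ zx≈zy ⟩
    z ⁻¹ * (z * y)     ≈⟨ solve 3 (λ z z' y → z' :* (z :* y) := (z :* z') :* y) refl z (z ⁻¹) y ⟩
    (z * z ⁻¹) * y     ≈⟨ *-congʳ (⁻¹-inverse z z≉0) ⟩
    1# * y             ≈⟨ *-identityˡ y ⟩
    y                  ∎

  ⁻¹-distrib-* : ∀ {x y} → ¬ (x ≈ 0#) → ¬ (y ≈ 0#) → (x * y) ⁻¹ ≈ x ⁻¹ * y ⁻¹
  ⁻¹-distrib-* {x} {y} x≉0 y≉0 = *-cancelˡ xy≉0 (trans (⁻¹-inverse (x * y) xy≉0) (sym xy·x⁻¹y⁻¹≈1))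
    where
    xy·x⁻¹y⁻¹≈1 : (x * y) * (x ⁻¹ * y ⁻¹) ≈ 1#
    xy·x⁻¹y⁻¹≈1 = begin
      (x * y) * (x ⁻¹ * y ⁻¹)
        ≈⟨ solve 4 (λ x x' y y' → (x :* y) :* (x' :* y') := (x :* x') :* (y :* y')) refl x (x ⁻¹) y (y ⁻¹) ⟩
      (x * x ⁻¹) * (y * y ⁻¹)  ≈⟨ *-cong (⁻¹-inverse x x≉0) (⁻¹-inverse y y≉0) ⟩
      1# * 1#                  ≈⟨ *-identityʳ 1# ⟩
      1#                       ∎
    -- no zero divisors: were x * y ≈ 0, the product above would be 0.
    xy≉0 : ¬ (x * y ≈ 0#)
    xy≉0 xy≈0 = 0#≉1# (trans (sym (trans (*-congʳ xy≈0) (zeroˡ _))) xy·x⁻¹y⁻¹≈1)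

  partial-fractions : ∀ {x y} A B → ¬ (x ≈ 0#) → ¬ (y ≈ 0#) →
                      (A * y - B * x) / (y * x) ≈ A / x - B / y
  partial-fractions {x} {y} A B x≉0 y≉0 = begin
    (A * y - B * x) * (y * x) ⁻¹
      ≈⟨ *-congˡ (⁻¹-distrib-* y≉0 x≉0) ⟩
    (A * y - B * x) * (y ⁻¹ * x ⁻¹)
      ≈⟨ solve 6 (λ A B x x' y y' → (A :* y :- B :* x) :* (y' :* x')
                                    := A :* (y :* y') :* x' :- B :* (x :* x') :* y')
               refl A B x (x ⁻¹) y (y ⁻¹) ⟩
    A * (y * y ⁻¹) * x ⁻¹ - B * (x * x ⁻¹) * y ⁻¹
      ≈⟨ +-cong (*-congʳ (*-congˡ (⁻¹-inverse y y≉0))) (-‿cong (*-congʳ (*-congˡ (⁻¹-inverse x x≉0)))) ⟩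
    A * 1# * x ⁻¹ - B * 1# * y ⁻¹
      ≈⟨ +-cong (*-congʳ (*-identityʳ A)) (-‿cong (*-congʳ (*-identityʳ B))) ⟩
    A * x ⁻¹ - B * y ⁻¹ ∎

module HoradamIdentities {c ℓ : Level} (F : Field c ℓ) (p q : Field.Carrier F)
                         (q≉0 : ¬ (Field._≈_ F q (Field.0# F))) where
  open Field F
  open Horadam F
  open FieldProperties F
  open ℤ-Coefficients commutativeRing using (solve; _:=_; _:+_; _:*_; _:-_; :-_; con)
  open import Relation.Binary.Reasoning.Setoid setoid

  W : Carrier → Carrier → ℤ → Carrier
  W = w p q

  U : ℤ → Carrier
  U = u p q

  Recurrent : (ℤ → Carrier) → Set ℓ
  Recurrent x = ∀ j → x (ℤ.suc (ℤ.suc j)) ≈ p * x (ℤ.suc j) - q * x j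

  backward-forward : ∀ y₀ y₁ → y₁ ≈ p * y₀ - q * ((p * y₀ - y₁) / q)
  backward-forward y₀ y₁ = sym (begin
    p * y₀ - q * ((p * y₀ - y₁) * q ⁻¹)
      ≈⟨ solve 5 (λ p q q' y₀ y₁ → p :* y₀ :- q :* ((p :* y₀ :- y₁) :* q')
                                   := y₁ :+ (con (+ 1) :- q :* q') :* (p :* y₀ :- y₁))
               refl p q (q ⁻¹) y₀ y₁ ⟩
    y₁ + (1# - q * q ⁻¹) * (p * y₀ - y₁)
      ≈⟨ +-congˡ (*-congʳ (+-congˡ (-‿cong (⁻¹-inverse q q≉0)))) ⟩
    y₁ + (1# - 1#) * (p * y₀ - y₁)  ≈⟨ +-congˡ (*-congʳ (-‿inverseʳ 1#)) ⟩
    y₁ + 0# * (p * y₀ - y₁)         ≈⟨ +-congˡ (zeroˡ _) ⟩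
    y₁ + 0#                         ≈⟨ +-identityʳ y₁ ⟩
    y₁                              ∎)

  W-recurrent : ∀ a b → Recurrent (W a b)
  W-recurrent a b (+ n)              = refl
  W-recurrent a b -[1+ zero ]        = backward-forward a b
  W-recurrent a b -[1+ suc zero ]    = backward-forward _ a
  W-recurrent a b -[1+ suc (suc k) ] = backward-forward _ _

  U-recurrent : Recurrent U
  U-recurrent = W-recurrent 0# 1#

  -- A recurrent sequence is determined by two consecutive values: the
  -- recurrence propagates agreement upwards, and (as q ≠ 0) downwards.
  recurrent-unique : ∀ {x y} → Recurrent x → Recurrent y →
                     x (+ 0) ≈ y (+ 0) → x (+ 1) ≈ y (+ 1) → ∀ j → x j ≈ y j
  recurrent-unique {x} {y} x-rec y-rec x₀≈y₀ x₁≈y₁ j =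
    proj₁ (ℤ-bi-induction AgreeAt (x₀≈y₀ , x₁≈y₁) up down j)
    where
    AgreeAt : ℤ → Set ℓ
    AgreeAt i = x i ≈ y i × x (ℤ.suc i) ≈ y (ℤ.suc i)
    up : ∀ i → AgreeAt i → AgreeAt (ℤ.suc i)
    up i (xᵢ≈yᵢ , xᵢ₊₁≈yᵢ₊₁) =
      xᵢ₊₁≈yᵢ₊₁ , trans (x-rec i) (trans (+-cong (*-congˡ xᵢ₊₁≈yᵢ₊₁) (-‿cong (*-congˡ xᵢ≈yᵢ))) (sym (y-rec i)))
    solve-for-q-term : ∀ {z} → Recurrent z → ∀ i → q * z i ≈ p * z (ℤ.suc i) - z (ℤ.suc (ℤ.suc i))
    solve-for-q-term {z} z-rec i = begin
      q * z i
        ≈⟨ solve 4 (λ p q a b → q :* a := p :* b :- (p :* b :- q :* a)) refl p q (z i) (z (ℤ.suc i)) ⟩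
      p * z (ℤ.suc i) - (p * z (ℤ.suc i) - q * z i)  ≈⟨ +-congˡ (-‿cong (z-rec i)) ⟨
      p * z (ℤ.suc i) - z (ℤ.suc (ℤ.suc i))          ∎
    down : ∀ i → AgreeAt (ℤ.suc i) → AgreeAt i
    down i (xᵢ₊₁≈yᵢ₊₁ , xᵢ₊₂≈yᵢ₊₂) =
      *-cancelˡ q≉0 (trans (solve-for-q-term x-rec i)
                    (trans (+-cong (*-congˡ xᵢ₊₁≈yᵢ₊₁) (-‿cong xᵢ₊₂≈yᵢ₊₂)) (sym (solve-for-q-term y-rec i))))
      , xᵢ₊₁≈yᵢ₊₁

  recurrent-resp : ∀ {x y} → Recurrent x → (∀ j → x j ≈ y j) → Recurrent y
  recurrent-resp x-rec x≈y j =
    trans (sym (x≈y _)) (trans (x-rec j) (+-cong (*-congˡ (x≈y _)) (-‿cong (*-congˡ (x≈y _)))))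

  recurrent-shift : ∀ {x} → Recurrent x → ∀ c → Recurrent (λ j → x (j ℤ.+ c))
  recurrent-shift {x} x-rec c j = begin
    x (ℤ.suc (ℤ.suc j) ℤ.+ c)                  ≡⟨ P.cong x (suc-suc-+ j c) ⟩
    x (ℤ.suc (ℤ.suc (j ℤ.+ c)))                ≈⟨ x-rec (j ℤ.+ c) ⟩
    p * x (ℤ.suc (j ℤ.+ c)) - q * x (j ℤ.+ c)  ≡⟨ P.cong (λ i → p * x i - q * x (j ℤ.+ c)) (suc-+ j c) ⟨
    p * x (ℤ.suc j ℤ.+ c) - q * x (j ℤ.+ c)    ∎
    where
    suc-+ : ∀ i c → ℤ.suc i ℤ.+ c ≡ ℤ.suc (i ℤ.+ c)
    suc-+ = ℤP.+-assoc (+ 1)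
    suc-suc-+ : ∀ i c → ℤ.suc (ℤ.suc i) ℤ.+ c ≡ ℤ.suc (ℤ.suc (i ℤ.+ c))
    suc-suc-+ i c = P.trans (suc-+ (ℤ.suc i) c) (P.cong ℤ.suc (suc-+ i c))

  recurrent-scale : ∀ {x} → Recurrent x → ∀ α → Recurrent (λ j → α * x j)
  recurrent-scale {x} x-rec α j = begin
    α * x (ℤ.suc (ℤ.suc j))                      ≈⟨ *-congˡ (x-rec j) ⟩
    α * (p * x (ℤ.suc j) - q * x j)
      ≈⟨ solve 5 (λ α p q x₁ x₀ → α :* (p :* x₁ :- q :* x₀) := p :* (α :* x₁) :- q :* (α :* x₀))
               refl α p q (x (ℤ.suc j)) (x j) ⟩
    p * (α * x (ℤ.suc j)) - q * (α * x j)        ∎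

  recurrent-combination : ∀ {x y} → Recurrent x → Recurrent y → ∀ α β → Recurrent (λ j → α * x j + β * y j)
  recurrent-combination {x} {y} x-rec y-rec α β j = begin
    α * x (ℤ.suc (ℤ.suc j)) + β * y (ℤ.suc (ℤ.suc j))
      ≈⟨ +-cong (recurrent-scale x-rec α j) (recurrent-scale y-rec β j) ⟩
    (p * (α * x (ℤ.suc j)) - q * (α * x j)) + (p * (β * y (ℤ.suc j)) - q * (β * y j))
      ≈⟨ solve 6 (λ p q x₁ x₀ y₁ y₀ → (p :* x₁ :- q :* x₀) :+ (p :* y₁ :- q :* y₀)
                                      := p :* (x₁ :+ y₁) :- q :* (x₀ :+ y₀))
               refl p q (α * x (ℤ.suc j)) (α * x j) (β * y (ℤ.suc j)) (β * y j) ⟩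
    p * (α * x (ℤ.suc j) + β * y (ℤ.suc j)) - q * (α * x j + β * y j) ∎

  zpow-suc : ∀ i → zpow q (ℤ.suc i) ≈ q * zpow q i
  zpow-suc (+ n)             = refl
  zpow-suc -[1+ zero ]       = sym (trans (*-congˡ (*-identityʳ (q ⁻¹))) (⁻¹-inverse q q≉0))
  zpow-suc -[1+ suc n ]      = sym (begin
    q * (q ⁻¹ * pow (q ⁻¹) (suc n))  ≈⟨ *-assoc q (q ⁻¹) _ ⟨
    (q * q ⁻¹) * pow (q ⁻¹) (suc n)  ≈⟨ *-congʳ (⁻¹-inverse q q≉0) ⟩
    1# * pow (q ⁻¹) (suc n)          ≈⟨ *-identityˡ _ ⟩
    pow (q ⁻¹) (suc n)               ∎)

  zpow-+ : ∀ i j → zpow q (i ℤ.+ j) ≈ zpow q i * zpow q j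
  zpow-+ = ℤ-bi-induction AddsExponents base up down
    where
    AddsExponents : ℤ → Set ℓ
    AddsExponents i = ∀ j → zpow q (i ℤ.+ j) ≈ zpow q i * zpow q j
    base : AddsExponents (+ 0)
    base j = trans (reflexive (P.cong (zpow q) (ℤP.+-identityˡ j))) (sym (*-identityˡ _))
    shift : ∀ i j → zpow q (ℤ.suc i ℤ.+ j) ≈ q * zpow q (i ℤ.+ j)
    shift i j = trans (reflexive (P.cong (zpow q) (ℤP.+-assoc (+ 1) i j))) (zpow-suc (i ℤ.+ j))
    up : ∀ i → AddsExponents i → AddsExponents (ℤ.suc i)
    up i hyp j = begin
      zpow q (ℤ.suc i ℤ.+ j)        ≈⟨ shift i j ⟩
      q * zpow q (i ℤ.+ j)          ≈⟨ *-congˡ (hyp j) ⟩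
      q * (zpow q i * zpow q j)     ≈⟨ *-assoc _ _ _ ⟨
      (q * zpow q i) * zpow q j     ≈⟨ *-congʳ (zpow-suc i) ⟨
      zpow q (ℤ.suc i) * zpow q j   ∎
    down : ∀ i → AddsExponents (ℤ.suc i) → AddsExponents i
    down i hyp j = *-cancelˡ q≉0 (begin
      q * zpow q (i ℤ.+ j)          ≈⟨ shift i j ⟨
      zpow q (ℤ.suc i ℤ.+ j)        ≈⟨ hyp j ⟩
      zpow q (ℤ.suc i) * zpow q j   ≈⟨ *-congʳ (zpow-suc i) ⟩
      (q * zpow q i) * zpow q j     ≈⟨ *-assoc _ _ _ ⟩
      q * (zpow q i * zpow q j)     ∎)

  zpow-* : ∀ i j → pow (zpow q i) j ≈ zpow q (i ℤ.* + j)
  zpow-* i zero    = reflexive (P.cong (zpow q) (P.sym (ℤP.*-zeroʳ i)))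
  zpow-* i (suc j) = begin
    zpow q i * pow (zpow q i) j       ≈⟨ *-congˡ (zpow-* i j) ⟩
    zpow q i * zpow q (i ℤ.* + j)     ≈⟨ zpow-+ i (i ℤ.* + j) ⟨
    zpow q (i ℤ.+ i ℤ.* + j)          ≡⟨ P.cong (zpow q) (P.sym (ℤP.*-suc i (+ j))) ⟩
    zpow q (i ℤ.* + suc j)            ∎

  pow-distrib-* : ∀ x y j → pow (x * y) j ≈ pow x j * pow y j
  pow-distrib-* x y zero    = sym (*-identityˡ 1#)
  pow-distrib-* x y (suc j) = trans (*-congˡ (pow-distrib-* x y j))
    (solve 4 (λ x y xʲ yʲ → (x :* y) :* (xʲ :* yʲ) := (x :* xʲ) :* (y :* yʲ)) refl x y (pow x j) (pow y j))

  casoratian : (ℤ → Carrier) → (ℤ → Carrier) → ℤ → Carrier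
  casoratian x y i = x (ℤ.suc i) * y i - x i * y (ℤ.suc i)

  casoratian-step : ∀ {x y} → Recurrent x → Recurrent y → ∀ i →
                    casoratian x y (ℤ.suc i) ≈ q * casoratian x y i
  casoratian-step {x} {y} x-rec y-rec i = begin
    x₂ * y₁ - x₁ * y₂
      ≈⟨ +-cong (*-congʳ (x-rec i)) (-‿cong (*-congˡ (y-rec i))) ⟩
    (p * x₁ - q * x₀) * y₁ - x₁ * (p * y₁ - q * y₀)
      ≈⟨ solve 6 (λ p q x₀ x₁ y₀ y₁ → (p :* x₁ :- q :* x₀) :* y₁ :- x₁ :* (p :* y₁ :- q :* y₀)
                                      := q :* (x₁ :* y₀ :- x₀ :* y₁))
               refl p q x₀ x₁ y₀ y₁ ⟩
    q * (x₁ * y₀ - x₀ * y₁) ∎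
    where
    x₀ x₁ x₂ y₀ y₁ y₂ : Carrier
    x₀ = x i
    x₁ = x (ℤ.suc i)
    x₂ = x (ℤ.suc (ℤ.suc i))
    y₀ = y i
    y₁ = y (ℤ.suc i)
    y₂ = y (ℤ.suc (ℤ.suc i))

  casoratian-geometric : ∀ {x y} → Recurrent x → Recurrent y → ∀ i →
                         casoratian x y i ≈ zpow q i * casoratian x y (+ 0)
  casoratian-geometric {x} {y} x-rec y-rec =
    ℤ-bi-induction Geometric (sym (*-identityˡ _)) up down
    where
    C₀ : Carrier
    C₀ = casoratian x y (+ 0)
    Geometric : ℤ → Set ℓ
    Geometric i = casoratian x y i ≈ zpow q i * C₀
    absorb : ∀ i → q * (zpow q i * C₀) ≈ zpow q (ℤ.suc i) * C₀
    absorb i = trans (sym (*-assoc q _ C₀)) (*-congʳ (sym (zpow-suc i)))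
    up : ∀ i → Geometric i → Geometric (ℤ.suc i)
    up i hyp = trans (casoratian-step x-rec y-rec i) (trans (*-congˡ hyp) (absorb i))
    down : ∀ i → Geometric (ℤ.suc i) → Geometric i
    down i hyp = *-cancelˡ q≉0 (trans (sym (casoratian-step x-rec y-rec i)) (trans hyp (sym (absorb i))))

  -- Since u_0 = 0 and u_1 = 1, the Casoratian of u and y at 0 is y_0.
  casoratian-U-at-0 : ∀ y → casoratian U y (+ 0) ≈ y (+ 0)
  casoratian-U-at-0 y =
    solve 2 (λ y₀ y₁ → con (+ 1) :* y₀ :- con (+ 0) :* y₁ := y₀) refl (y (+ 0)) (y (+ 1))

  -- As functions of δ both sides are recurrent; at δ = 0 both vanish, and
  -- at δ = 1 the left side is minus a Casoratian of u and the shifted w.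
  index-reduction : ∀ a b α δ K →
    U α * W a b ((δ ℤ.+ α) ℤ.+ K) - U (δ ℤ.+ α) * W a b (α ℤ.+ K) ≈ - (zpow q α * U δ * W a b K)
  index-reduction a b α δ K = begin
    lhs δ  ≈⟨ recurrent-unique lhs-recurrent rhs-recurrent at-0 at-1 δ ⟩
    rhs δ  ≈⟨ solve 3 (λ c w u → :- (c :* w) :* u := :- (c :* u :* w)) refl (zpow q α) (W a b K) (U δ) ⟩
    - (zpow q α * U δ * W a b K) ∎
    where
    y : ℤ → Carrier
    y j = W a b (j ℤ.+ K)
    y₀≈wK : y (+ 0) ≈ W a b K
    y₀≈wK = reflexive (P.cong (W a b) (ℤP.+-identityˡ K))
    lhs rhs : ℤ → Carrier
    lhs t = U α * y (t ℤ.+ α) - U (t ℤ.+ α) * y α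
    rhs t = - (zpow q α * W a b K) * U t
    lhs-recurrent : Recurrent lhs
    lhs-recurrent = recurrent-resp
      (recurrent-combination (recurrent-shift (recurrent-shift (W-recurrent a b) K) α)
                             (recurrent-shift U-recurrent α) (U α) (- y α))
      (λ t → solve 4 (λ uα yₜ yα uₜ → uα :* yₜ :+ (:- yα) :* uₜ := uα :* yₜ :- uₜ :* yα)
                     refl (U α) (y (t ℤ.+ α)) (y α) (U (t ℤ.+ α)))
    rhs-recurrent : Recurrent rhs
    rhs-recurrent = recurrent-scale U-recurrent (- (zpow q α * W a b K))
    at-0 : lhs (+ 0) ≈ rhs (+ 0)
    at-0 = begin
      lhs (+ 0)                    ≡⟨ P.cong (λ i → U α * y i - U i * y α) (ℤP.+-identityˡ α) ⟩
      U α * y α - U α * y α        ≈⟨ -‿inverseʳ _ ⟩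
      0#                           ≈⟨ zeroʳ _ ⟨
      rhs (+ 0)                    ∎
    at-1 : lhs (+ 1) ≈ rhs (+ 1)
    at-1 = begin
      U α * y (ℤ.suc α) - U (ℤ.suc α) * y α
        ≈⟨ solve 4 (λ a b c d → a :* b :- c :* d := :- (c :* d :- a :* b)) refl (U α) (y (ℤ.suc α)) (U (ℤ.suc α)) (y α) ⟩
      - casoratian U y α                   ≈⟨ -‿cong (casoratian-geometric U-recurrent (recurrent-shift (W-recurrent a b) K) α) ⟩
      - (zpow q α * casoratian U y (+ 0))  ≈⟨ -‿cong (*-congˡ (trans (casoratian-U-at-0 y) y₀≈wK)) ⟩
      - (zpow q α * W a b K)               ≈⟨ *-identityʳ _ ⟨
      rhs (+ 1)                            ∎

  index-reduction′ : ∀ a b α β δ K I₁ I₂ → δ ℤ.+ α ≡ β → β ℤ.+ K ≡ I₁ → α ℤ.+ K ≡ I₂ →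
    U α * W a b I₁ - U β * W a b I₂ ≈ - (zpow q α * U δ * W a b K)
  index-reduction′ a b α _ δ K _ _ P.refl P.refl P.refl = index-reduction a b α δ K

  sumTo-cong : ∀ k {f g : ℕ → Carrier} → (∀ j → j ≤ k → f j ≈ g j) → sumTo k f ≈ sumTo k g
  sumTo-cong zero    f≈g = f≈g 0 ℕ.z≤n
  sumTo-cong (suc k) f≈g =
    +-cong (sumTo-cong k (λ j j≤k → f≈g j (ℕP.m≤n⇒m≤1+n j≤k))) (f≈g (suc k) ℕP.≤-refl)

  sumTo-*ˡ : ∀ k x (f : ℕ → Carrier) → x * sumTo k f ≈ sumTo k (λ j → x * f j)
  sumTo-*ˡ zero    x f = refl
  sumTo-*ˡ (suc k) x f = trans (distribˡ x _ _) (+-congʳ (sumTo-*ˡ k x f))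

  -- Weighted telescoping:
  --   Σ_{j≤k} A^{k−j} B^j (A h_j − B h_{j+1}) = A^{k+1} h_0 − B^{k+1} h_{k+1}.
  -- Passing from k to k+1 multiplies the old terms by A and adds one new term.
  telescope : ∀ A B (h : ℕ → Carrier) k →
    sumTo k (λ j → pow A (k ∸ j) * pow B j * (A * h j - B * h (suc j)))
      ≈ pow A (suc k) * h 0 - pow B (suc k) * h (suc k)
  telescope A B h zero = solve 4
    (λ A B h₀ h₁ → con (+ 1) :* con (+ 1) :* (A :* h₀ :- B :* h₁)
                   := (A :* con (+ 1)) :* h₀ :- (B :* con (+ 1)) :* h₁) refl A B (h 0) (h 1)
  telescope A B h (suc k) = begin
    sumTo k (term (suc k)) + term (suc k) (suc k)
      ≈⟨ +-congʳ (sumTo-cong k older-terms) ⟩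
    sumTo k (λ j → A * term k j) + term (suc k) (suc k)
      ≈⟨ +-congʳ (sumTo-*ˡ k A (term k)) ⟨
    A * sumTo k (term k) + term (suc k) (suc k)
      ≈⟨ +-congʳ (*-congˡ (telescope A B h k)) ⟩
    A * (Aᵏ⁺¹ * h 0 - Bᵏ⁺¹ * h (suc k)) + pow A (k ∸ k) * Bᵏ⁺¹ * (A * h (suc k) - B * h (suc (suc k)))
      ≡⟨ P.cong (λ e → A * (Aᵏ⁺¹ * h 0 - Bᵏ⁺¹ * h (suc k)) + pow A e * Bᵏ⁺¹ * (A * h (suc k) - B * h (suc (suc k))))
                (ℕP.n∸n≡0 k) ⟩
    A * (Aᵏ⁺¹ * h 0 - Bᵏ⁺¹ * h (suc k)) + 1# * Bᵏ⁺¹ * (A * h (suc k) - B * h (suc (suc k)))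
      ≈⟨ solve 7 (λ A B Aᵏ⁺¹ Bᵏ⁺¹ h₀ h₁ h₂ →
                    A :* (Aᵏ⁺¹ :* h₀ :- Bᵏ⁺¹ :* h₁) :+ con (+ 1) :* Bᵏ⁺¹ :* (A :* h₁ :- B :* h₂)
                    := (A :* Aᵏ⁺¹) :* h₀ :- (B :* Bᵏ⁺¹) :* h₂)
               refl A B Aᵏ⁺¹ Bᵏ⁺¹ (h 0) (h (suc k)) (h (suc (suc k))) ⟩
    pow A (suc (suc k)) * h 0 - pow B (suc (suc k)) * h (suc (suc k)) ∎
    where
    Aᵏ⁺¹ Bᵏ⁺¹ : Carrier
    Aᵏ⁺¹ = pow A (suc k)
    Bᵏ⁺¹ = pow B (suc k)
    term : ℕ → ℕ → Carrier
    term m j = pow A (m ∸ j) * pow B j * (A * h j - B * h (suc j))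
    older-terms : ∀ j → j ≤ k → term (suc k) j ≈ A * term k j
    older-terms j j≤k = begin
      pow A (suc k ∸ j) * pow B j * (A * h j - B * h (suc j))
        ≡⟨ P.cong (λ e → pow A e * pow B j * (A * h j - B * h (suc j))) (ℕP.+-∸-assoc 1 j≤k) ⟩
      (A * pow A (k ∸ j)) * pow B j * (A * h j - B * h (suc j))
        ≈⟨ solve 4 (λ A Aᵉ Bʲ d → (A :* Aᵉ) :* Bʲ :* d := A :* (Aᵉ :* Bʲ :* d))
                 refl A (pow A (k ∸ j)) (pow B j) (A * h j - B * h (suc j)) ⟩
      A * term k j ∎

  -- Telescoping sums of fractions: if c X_j = A g_{j+1} − B g_j, then by
  -- partial fractions c X_j / (g_{j+1} g_j) = A / g_j − B / g_{j+1}, and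
  --   c g_{k+1} g_0 Σ_{j≤k} A^{k−j} B^j X_j / (g_{j+1} g_j) = A^{k+1} g_{k+1} − B^{k+1} g_0.
  telescoping-fractions : ∀ A B C (g X : ℕ → Carrier) k →
    (∀ j → j ≤ k → ¬ (g (suc j) ≈ 0#) × ¬ (g j ≈ 0#)) →
    (∀ j → j ≤ k → C * X j ≈ A * g (suc j) - B * g j) →
    C * g (suc k) * g 0 * sumTo k (λ j → pow A (k ∸ j) * pow B j * X j / (g (suc j) * g j))
      ≈ pow A (suc k) * g (suc k) - pow B (suc k) * g 0
  telescoping-fractions A B C g X k nonzero combination = begin
    C * g (suc k) * g 0 * sumTo k fraction
      ≈⟨ solve 4 (λ C x y S → C :* x :* y :* S := x :* y :* (C :* S)) refl C (g (suc k)) (g 0) (sumTo k fraction) ⟩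
    g (suc k) * g 0 * (C * sumTo k fraction)
      ≈⟨ *-congˡ (trans (sumTo-*ˡ k C fraction) (sumTo-cong k split)) ⟩
    g (suc k) * g 0 * sumTo k (λ j → pow A (k ∸ j) * pow B j * (A * h j - B * h (suc j)))
      ≈⟨ *-congˡ (telescope A B h k) ⟩
    g (suc k) * g 0 * (pow A (suc k) * h 0 - pow B (suc k) * h (suc k))
      ≈⟨ solve 6 (λ x y Aᵏ⁺¹ Bᵏ⁺¹ h₀ h₁ → x :* y :* (Aᵏ⁺¹ :* h₀ :- Bᵏ⁺¹ :* h₁)
                                          := Aᵏ⁺¹ :* x :* (y :* h₀) :- Bᵏ⁺¹ :* y :* (x :* h₁))
               refl (g (suc k)) (g 0) (pow A (suc k)) (pow B (suc k)) (h 0) (h (suc k)) ⟩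
    pow A (suc k) * g (suc k) * (g 0 * h 0) - pow B (suc k) * g 0 * (g (suc k) * h (suc k))
      ≈⟨ +-cong (*-congˡ (⁻¹-inverse _ (proj₂ (nonzero 0 ℕ.z≤n))))
                (-‿cong (*-congˡ (⁻¹-inverse _ (proj₁ (nonzero k ℕP.≤-refl))))) ⟩
    pow A (suc k) * g (suc k) * 1# - pow B (suc k) * g 0 * 1#
      ≈⟨ +-cong (*-identityʳ _) (-‿cong (*-identityʳ _)) ⟩
    pow A (suc k) * g (suc k) - pow B (suc k) * g 0 ∎
    where
    h : ℕ → Carrier
    h j = g j ⁻¹
    fraction : ℕ → Carrier
    fraction j = pow A (k ∸ j) * pow B j * X j / (g (suc j) * g j)
    split : ∀ j → j ≤ k → C * fraction j ≈ pow A (k ∸ j) * pow B j * (A * h j - B * h (suc j))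
    split j j≤k = begin
      C * (pow A (k ∸ j) * pow B j * X j * (g (suc j) * g j) ⁻¹)
        ≈⟨ solve 5 (λ C Aᵉ Bʲ x d → C :* (Aᵉ :* Bʲ :* x :* d) := Aᵉ :* Bʲ :* (C :* x :* d))
                 refl C (pow A (k ∸ j)) (pow B j) (X j) ((g (suc j) * g j) ⁻¹) ⟩
      pow A (k ∸ j) * pow B j * (C * X j / (g (suc j) * g j))
        ≈⟨ *-congˡ (*-congʳ (combination j j≤k)) ⟩
      pow A (k ∸ j) * pow B j * ((A * g (suc j) - B * g j) / (g (suc j) * g j))
        ≈⟨ *-congˡ (partial-fractions A B (proj₂ (nonzero j j≤k)) (proj₁ (nonzero j j≤k))) ⟩
      pow A (k ∸ j) * pow B j * (A * h j - B * h (suc j)) ∎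

  -- The denominator indices of the theorem: w_{N_j} w_{M_j} with
  -- N_j = n − dk + dj and M_j = N_j − d, so that M_{j+1} = N_j,
  -- M_{k+1} = n and M_0 = n − d(k+1).
  upper lower : ℤ → ℤ → ℕ → ℕ → ℤ
  upper d n k j = n ℤ.- d ℤ.* + k ℤ.+ d ℤ.* + j
  lower d n k j = n ℤ.- d ℤ.- d ℤ.* + k ℤ.+ d ℤ.* + j

  lower-shift : ∀ n d K J → d ℤ.+ (n ℤ.- d ℤ.- d ℤ.* K ℤ.+ d ℤ.* J) ≡ n ℤ.- d ℤ.* K ℤ.+ d ℤ.* J
  lower-shift = solve-∀

  NonzeroDenominators : Carrier → Carrier → ℤ → ℤ → ℕ → Set ℓ
  NonzeroDenominators a b d n k =
    ∀ j → j ≤ k → ¬ (W a b (upper d n k j) ≈ 0#) × ¬ (W a b (lower d n k j) ≈ 0#)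

  horadam-telescope : ∀ a b d n k A B C (X : ℕ → Carrier) → NonzeroDenominators a b d n k →
    (∀ j → j ≤ k → C * X j ≈ A * W a b (upper d n k j) - B * W a b (lower d n k j)) →
    C * W a b n * W a b (n ℤ.- d ℤ.* + suc k)
      * sumTo k (λ j → pow A (k ∸ j) * pow B j * X j / (W a b (upper d n k j) * W a b (lower d n k j)))
      ≈ pow A (suc k) * W a b n - pow B (suc k) * W a b (n ℤ.- d ℤ.* + suc k)
  horadam-telescope a b d n k A B C X nonzero combination = begin
    C * W a b n * W a b (n ℤ.- d ℤ.* + suc k) * sumTo k (λ j → fraction j (W a b (upper d n k j)))
      ≈⟨ *-congˡ (sumTo-cong k (λ j _ → reflexive (P.cong (λ i → fraction j (W a b i)) (lower-suc j)))) ⟨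
    C * W a b n * W a b (n ℤ.- d ℤ.* + suc k) * sumTo k (λ j → fraction j (g (suc j)))
      ≡⟨ P.cong₂ (λ x y → C * W a b x * W a b y * sumTo k (λ j → fraction j (g (suc j)))) lower-last lower-first ⟨
    C * g (suc k) * g 0 * sumTo k (λ j → fraction j (g (suc j)))
      ≈⟨ telescoping-fractions A B C g X k nonzero′ combination′ ⟩
    pow A (suc k) * g (suc k) - pow B (suc k) * g 0
      ≡⟨ P.cong₂ (λ x y → pow A (suc k) * W a b x - pow B (suc k) * W a b y) lower-last lower-first ⟩
    pow A (suc k) * W a b n - pow B (suc k) * W a b (n ℤ.- d ℤ.* + suc k) ∎
    where
    g : ℕ → Carrier
    g j = W a b (lower d n k j)
    fraction : ℕ → Carrier → Carrier
    fraction j gⱼ₊₁ = pow A (k ∸ j) * pow B j * X j / (gⱼ₊₁ * g j)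
    lower-suc : ∀ j → lower d n k (suc j) ≡ upper d n k j
    lower-suc j = shift n d (+ k) (+ j)
      where
      shift : ∀ n d K J → n ℤ.- d ℤ.- d ℤ.* K ℤ.+ d ℤ.* (+ 1 ℤ.+ J) ≡ n ℤ.- d ℤ.* K ℤ.+ d ℤ.* J
      shift = solve-∀
    lower-last : lower d n k (suc k) ≡ n
    lower-last = last n d (+ k)
      where
      last : ∀ n d K → n ℤ.- d ℤ.- d ℤ.* K ℤ.+ d ℤ.* (+ 1 ℤ.+ K) ≡ n
      last = solve-∀
    lower-first : lower d n k 0 ≡ n ℤ.- d ℤ.* + suc k
    lower-first = first n d (+ k)
      where
      first : ∀ n d K → n ℤ.- d ℤ.- d ℤ.* K ℤ.+ d ℤ.* + 0 ≡ n ℤ.- d ℤ.* (+ 1 ℤ.+ K)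
      first = solve-∀
    nonzero′ : ∀ j → j ≤ k → ¬ (g (suc j) ≈ 0#) × ¬ (g j ≈ 0#)
    nonzero′ j j≤k = P.subst (λ i → ¬ (W a b i ≈ 0#)) (P.sym (lower-suc j)) (proj₁ (nonzero j j≤k))
                   , proj₂ (nonzero j j≤k)
    combination′ : ∀ j → j ≤ k → C * X j ≈ A * g (suc j) - B * g j
    combination′ j j≤k = P.subst (λ i → C * X j ≈ A * W a b i - B * g j) (P.sym (lower-suc j)) (combination j j≤k)

  pow-q-scaled : ∀ α x j → pow (zpow q α * x) j ≈ zpow q (α ℤ.* + j) * pow x j
  pow-q-scaled α x j = trans (pow-distrib-* (zpow q α) x j) (*-congʳ (zpow-* α j))

  pow-minus-q-scaled : ∀ α x j → pow (- 1# * (zpow q α * x)) j ≈ pow (- 1#) j * zpow q (α ℤ.* + j) * pow x j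
  pow-minus-q-scaled α x j =
    trans (pow-distrib-* (- 1#) _ j) (trans (*-congˡ (pow-q-scaled α x j)) (sym (*-assoc _ _ _)))

  -- In each, (★) with K = X_j or K = M_j
  -- provides the hypothesis of horadam-telescope; they differ in which
  -- u-factor of (★) is moved to the front.
  -- Shape I (identities 1 and 4): (★) at K = X_j, with A = u_α, B = u_β.
  shape-I : ∀ a b α β δ d n k (X : ℕ → ℤ) → NonzeroDenominators a b d n k →
    δ ℤ.+ α ≡ β → (∀ j → β ℤ.+ X j ≡ upper d n k j) → (∀ j → α ℤ.+ X j ≡ lower d n k j) →
    - (zpow q α * U δ * W a b n * W a b (n ℤ.- d ℤ.* + suc k))
      * sumTo k (λ j → pow (U α) (k ∸ j) * pow (U β) j * W a b (X j)
                       / (W a b (upper d n k j) * W a b (lower d n k j)))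
      ≈ pow (U α) (suc k) * W a b n - pow (U β) (suc k) * W a b (n ℤ.- d ℤ.* + suc k)
  shape-I a b α β δ d n k X nonzero δ+α≡β β+X≡N α+X≡M =
    trans (*-congʳ (solve 4 (λ z u x y → :- (z :* u :* x :* y) := :- (z :* u) :* x :* y)
                            refl (zpow q α) (U δ) (W a b n) (W a b (n ℤ.- d ℤ.* + suc k))))
          (horadam-telescope a b d n k (U α) (U β) (- (zpow q α * U δ)) (λ j → W a b (X j)) nonzero combination)
    where
    combination : ∀ j → j ≤ k →
      - (zpow q α * U δ) * W a b (X j) ≈ U α * W a b (upper d n k j) - U β * W a b (lower d n k j)
    combination j _ = trans (solve 3 (λ z u x → :- (z :* u) :* x := :- (z :* u :* x)) refl (zpow q α) (U δ) (W a b (X j)))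
                            (sym (index-reduction′ a b α β δ (X j) _ _ δ+α≡β (β+X≡N j) (α+X≡M j)))

  -- Shape II (identities 2 and 5): d = β, (★) at K = M_j, with A = u_α,
  -- B = −q^α u_δ and the prefactor u_β.
  shape-II : ∀ a b α β δ n k (X : ℕ → ℤ) → NonzeroDenominators a b β n k →
    δ ℤ.+ α ≡ β → (∀ j → α ℤ.+ lower β n k j ≡ X j) →
    U β * W a b n * W a b (n ℤ.- β ℤ.* + suc k)
      * sumTo k (λ j → pow (- 1#) j * zpow q (α ℤ.* + j) * pow (U α) (k ∸ j) * pow (U δ) j * W a b (X j)
                       / (W a b (upper β n k j) * W a b (lower β n k j)))
      ≈ pow (U α) (suc k) * W a b n
        - pow (- 1#) (suc k) * zpow q (α ℤ.* + suc k) * pow (U δ) (suc k) * W a b (n ℤ.- β ℤ.* + suc k)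
  shape-II a b α β δ n k X nonzero δ+α≡β α+M≡X =
    trans (*-congˡ (sumTo-cong k (λ j _ → regroup j)))
          (trans (horadam-telescope a b β n k (U α) B (U β) (λ j → W a b (X j)) nonzero combination)
                 (+-congˡ (-‿cong (*-congʳ (pow-minus-q-scaled α (U δ) (suc k))))))
    where
    B : Carrier
    B = - 1# * (zpow q α * U δ)
    combination : ∀ j → j ≤ k → U β * W a b (X j) ≈ U α * W a b (upper β n k j) - B * W a b (lower β n k j)
    combination j _ = begin
      U β * W a b (X j)
        ≈⟨ solve 2 (λ x y → x := y :- (y :- x)) refl (U β * W a b (X j)) (U α * W a b (upper β n k j)) ⟩
      U α * W a b (upper β n k j) - (U α * W a b (upper β n k j) - U β * W a b (X j))
        ≈⟨ +-congˡ (-‿cong (index-reduction′ a b α β δ (lower β n k j) _ _ δ+α≡β (lower-shift n β (+ k) (+ j)) (α+M≡X j))) ⟩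
      U α * W a b (upper β n k j) - - (zpow q α * U δ * W a b (lower β n k j))
        ≈⟨ solve 4 (λ y z u m → y :- :- (z :* u :* m) := y :- (:- con (+ 1) :* (z :* u)) :* m)
                 refl (U α * W a b (upper β n k j)) (zpow q α) (U δ) (W a b (lower β n k j)) ⟩
      U α * W a b (upper β n k j) - B * W a b (lower β n k j) ∎
    regroup : ∀ j → pow (- 1#) j * zpow q (α ℤ.* + j) * pow (U α) (k ∸ j) * pow (U δ) j * W a b (X j)
                      / (W a b (upper β n k j) * W a b (lower β n k j))
                    ≈ pow (U α) (k ∸ j) * pow B j * W a b (X j) / (W a b (upper β n k j) * W a b (lower β n k j))
    regroup j = sym (trans (*-congʳ (*-congʳ (*-congˡ (pow-minus-q-scaled α (U δ) j))))
      (solve 6 (λ Aᵉ s z uʲ x d → Aᵉ :* (s :* z :* uʲ) :* x :* d := s :* z :* Aᵉ :* uʲ :* x :* d) refl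
        (pow (U α) (k ∸ j)) (pow (- 1#) j) (zpow q (α ℤ.* + j)) (pow (U δ) j) (W a b (X j))
        ((W a b (upper β n k j) * W a b (lower β n k j)) ⁻¹)))

  -- Shape III (identities 3 and 6): d = α, (★) at K = M_j, with A = u_β,
  -- B = q^α u_δ and the prefactor u_α.
  shape-III : ∀ a b α β δ n k (X : ℕ → ℤ) → NonzeroDenominators a b α n k →
    δ ℤ.+ α ≡ β → (∀ j → β ℤ.+ lower α n k j ≡ X j) →
    U α * W a b n * W a b (n ℤ.- α ℤ.* + suc k)
      * sumTo k (λ j → zpow q (α ℤ.* + j) * pow (U β) (k ∸ j) * pow (U δ) j * W a b (X j)
                       / (W a b (upper α n k j) * W a b (lower α n k j)))
      ≈ pow (U β) (suc k) * W a b n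
        - zpow q (α ℤ.* + suc k) * pow (U δ) (suc k) * W a b (n ℤ.- α ℤ.* + suc k)
  shape-III a b α β δ n k X nonzero δ+α≡β β+M≡X =
    trans (*-congˡ (sumTo-cong k (λ j _ → regroup j)))
          (trans (horadam-telescope a b α n k (U β) B (U α) (λ j → W a b (X j)) nonzero combination)
                 (+-congˡ (-‿cong (*-congʳ (pow-q-scaled α (U δ) (suc k))))))
    where
    B : Carrier
    B = zpow q α * U δ
    combination : ∀ j → j ≤ k → U α * W a b (X j) ≈ U β * W a b (upper α n k j) - B * W a b (lower α n k j)
    combination j _ = begin
      U α * W a b (X j)
        ≈⟨ solve 2 (λ x y → x := y :+ (x :- y)) refl (U α * W a b (X j)) (U β * W a b (upper α n k j)) ⟩
      U β * W a b (upper α n k j) + (U α * W a b (X j) - U β * W a b (upper α n k j))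
        ≈⟨ +-congˡ (index-reduction′ a b α β δ (lower α n k j) _ _ δ+α≡β (β+M≡X j) (lower-shift n α (+ k) (+ j))) ⟩
      U β * W a b (upper α n k j) + - (zpow q α * U δ * W a b (lower α n k j))
        ≈⟨ solve 4 (λ y z u m → y :+ :- (z :* u :* m) := y :- (z :* u) :* m)
                 refl (U β * W a b (upper α n k j)) (zpow q α) (U δ) (W a b (lower α n k j)) ⟩
      U β * W a b (upper α n k j) - B * W a b (lower α n k j) ∎
    regroup : ∀ j → zpow q (α ℤ.* + j) * pow (U β) (k ∸ j) * pow (U δ) j * W a b (X j)
                      / (W a b (upper α n k j) * W a b (lower α n k j))
                    ≈ pow (U β) (k ∸ j) * pow B j * W a b (X j) / (W a b (upper α n k j) * W a b (lower α n k j))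
    regroup j = sym (trans (*-congʳ (*-congʳ (*-congˡ (pow-q-scaled α (U δ) j))))
      (solve 5 (λ Aᵉ z uʲ x d → Aᵉ :* (z :* uʲ) :* x :* d := z :* Aᵉ :* uʲ :* x :* d) refl
        (pow (U β) (k ∸ j)) (zpow q (α ℤ.* + j)) (pow (U δ) j) (W a b (X j))
        ((W a b (upper α n k j) * W a b (lower α n k j)) ⁻¹)))

u-indices-minus : ∀ m r s → (m ℤ.- r) ℤ.+ (r ℤ.- s) ≡ m ℤ.- s
u-indices-minus = solve-∀

u-indices-plus : ∀ m r s → (m ℤ.+ s) ℤ.+ (r ℤ.- s) ≡ m ℤ.+ r
u-indices-plus = solve-∀

indices-1-upper : ∀ n m r s K J →
  (m ℤ.- s) ℤ.+ (n ℤ.- m ℤ.+ s ℤ.- (m ℤ.- r) ℤ.* K ℤ.+ (m ℤ.- r) ℤ.* J) ≡ n ℤ.- (m ℤ.- r) ℤ.* K ℤ.+ (m ℤ.- r) ℤ.* J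
indices-1-upper = solve-∀

indices-1-lower : ∀ n m r s K J →
  (r ℤ.- s) ℤ.+ (n ℤ.- m ℤ.+ s ℤ.- (m ℤ.- r) ℤ.* K ℤ.+ (m ℤ.- r) ℤ.* J)
    ≡ n ℤ.- (m ℤ.- r) ℤ.- (m ℤ.- r) ℤ.* K ℤ.+ (m ℤ.- r) ℤ.* J
indices-1-lower = solve-∀

indices-2 : ∀ n m r s K J →
  (r ℤ.- s) ℤ.+ (n ℤ.- (m ℤ.- s) ℤ.- (m ℤ.- s) ℤ.* K ℤ.+ (m ℤ.- s) ℤ.* J)
    ≡ n ℤ.- (m ℤ.- r) ℤ.- (m ℤ.- s) ℤ.* K ℤ.+ (m ℤ.- s) ℤ.* J
indices-2 = solve-∀

indices-3 : ∀ n m r s K J →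
  (m ℤ.- s) ℤ.+ (n ℤ.- (r ℤ.- s) ℤ.- (r ℤ.- s) ℤ.* K ℤ.+ (r ℤ.- s) ℤ.* J)
    ≡ n ℤ.+ m ℤ.- r ℤ.- (r ℤ.- s) ℤ.* K ℤ.+ (r ℤ.- s) ℤ.* J
indices-3 = solve-∀

indices-4-upper : ∀ n m r s K J →
  (m ℤ.+ r) ℤ.+ (n ℤ.- m ℤ.- r ℤ.- (m ℤ.+ s) ℤ.* K ℤ.+ (m ℤ.+ s) ℤ.* J) ≡ n ℤ.- (m ℤ.+ s) ℤ.* K ℤ.+ (m ℤ.+ s) ℤ.* J
indices-4-upper = solve-∀

indices-4-lower : ∀ n m r s K J →
  (r ℤ.- s) ℤ.+ (n ℤ.- m ℤ.- r ℤ.- (m ℤ.+ s) ℤ.* K ℤ.+ (m ℤ.+ s) ℤ.* J)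
    ≡ n ℤ.- (m ℤ.+ s) ℤ.- (m ℤ.+ s) ℤ.* K ℤ.+ (m ℤ.+ s) ℤ.* J
indices-4-lower = solve-∀

indices-5 : ∀ n m r s K J →
  (r ℤ.- s) ℤ.+ (n ℤ.- (m ℤ.+ r) ℤ.- (m ℤ.+ r) ℤ.* K ℤ.+ (m ℤ.+ r) ℤ.* J)
    ≡ n ℤ.- (m ℤ.+ s) ℤ.- (m ℤ.+ r) ℤ.* K ℤ.+ (m ℤ.+ r) ℤ.* J
indices-5 = solve-∀

indices-6 : ∀ n m r s K J →
  (m ℤ.+ r) ℤ.+ (n ℤ.- (r ℤ.- s) ℤ.- (r ℤ.- s) ℤ.* K ℤ.+ (r ℤ.- s) ℤ.* J)
    ≡ n ℤ.+ m ℤ.+ s ℤ.- (r ℤ.- s) ℤ.* K ℤ.+ (r ℤ.- s) ℤ.* J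
indices-6 = solve-∀

mainTheorem8 : ∀ {c ℓ : Level} (F : Field c ℓ) →
  let open Field F
      open Horadam F
  in (p q a b : Carrier) → ¬ (p ≈ 0#) → ¬ (q ≈ 0#) →
     (r s m n : ℤ) (k : ℕ) →
     -- all denominators occurring below are nonzero
     (∀ j → j ≤ k →
        ¬ (w p q a b (n ℤ.- (m ℤ.- r) ℤ.* + k ℤ.+ (m ℤ.- r) ℤ.* + j) ≈ 0#)
      × ¬ (w p q a b (n ℤ.- (m ℤ.- r) ℤ.- (m ℤ.- r) ℤ.* + k ℤ.+ (m ℤ.- r) ℤ.* + j) ≈ 0#)
      × ¬ (w p q a b (n ℤ.- (m ℤ.- s) ℤ.* + k ℤ.+ (m ℤ.- s) ℤ.* + j) ≈ 0#)
      × ¬ (w p q a b (n ℤ.- (m ℤ.- s) ℤ.- (m ℤ.- s) ℤ.* + k ℤ.+ (m ℤ.- s) ℤ.* + j) ≈ 0#)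
      × ¬ (w p q a b (n ℤ.- (r ℤ.- s) ℤ.* + k ℤ.+ (r ℤ.- s) ℤ.* + j) ≈ 0#)
      × ¬ (w p q a b (n ℤ.- (r ℤ.- s) ℤ.- (r ℤ.- s) ℤ.* + k ℤ.+ (r ℤ.- s) ℤ.* + j) ≈ 0#)
      × ¬ (w p q a b (n ℤ.- (m ℤ.+ s) ℤ.* + k ℤ.+ (m ℤ.+ s) ℤ.* + j) ≈ 0#)
      × ¬ (w p q a b (n ℤ.- (m ℤ.+ s) ℤ.- (m ℤ.+ s) ℤ.* + k ℤ.+ (m ℤ.+ s) ℤ.* + j) ≈ 0#)
      × ¬ (w p q a b (n ℤ.- (m ℤ.+ r) ℤ.* + k ℤ.+ (m ℤ.+ r) ℤ.* + j) ≈ 0#)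
      × ¬ (w p q a b (n ℤ.- (m ℤ.+ r) ℤ.- (m ℤ.+ r) ℤ.* + k ℤ.+ (m ℤ.+ r) ℤ.* + j) ≈ 0#)) →
     -- (1)
     (- (zpow q (r ℤ.- s) * u p q (m ℤ.- r) * w p q a b n * w p q a b (n ℤ.- (m ℤ.- r) ℤ.* + suc k))
        * sumTo k (λ j →
            pow (u p q (r ℤ.- s)) (k ∸ j) * pow (u p q (m ℤ.- s)) j
              * w p q a b (n ℤ.- m ℤ.+ s ℤ.- (m ℤ.- r) ℤ.* + k ℤ.+ (m ℤ.- r) ℤ.* + j)
            / (w p q a b (n ℤ.- (m ℤ.- r) ℤ.* + k ℤ.+ (m ℤ.- r) ℤ.* + j)
               * w p q a b (n ℤ.- (m ℤ.- r) ℤ.- (m ℤ.- r) ℤ.* + k ℤ.+ (m ℤ.- r) ℤ.* + j)))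
      ≈ pow (u p q (r ℤ.- s)) (suc k) * w p q a b n
        - pow (u p q (m ℤ.- s)) (suc k) * w p q a b (n ℤ.- (m ℤ.- r) ℤ.* + suc k))
     ×
     -- (2)
     ((u p q (m ℤ.- s) * w p q a b n * w p q a b (n ℤ.- (m ℤ.- s) ℤ.* + suc k))
        * sumTo k (λ j →
            pow (- 1#) j * zpow q ((r ℤ.- s) ℤ.* + j)
              * pow (u p q (r ℤ.- s)) (k ∸ j) * pow (u p q (m ℤ.- r)) j
              * w p q a b (n ℤ.- (m ℤ.- r) ℤ.- (m ℤ.- s) ℤ.* + k ℤ.+ (m ℤ.- s) ℤ.* + j)
            / (w p q a b (n ℤ.- (m ℤ.- s) ℤ.* + k ℤ.+ (m ℤ.- s) ℤ.* + j)
               * w p q a b (n ℤ.- (m ℤ.- s) ℤ.- (m ℤ.- s) ℤ.* + k ℤ.+ (m ℤ.- s) ℤ.* + j)))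
      ≈ pow (u p q (r ℤ.- s)) (suc k) * w p q a b n
        - pow (- 1#) (suc k) * zpow q ((r ℤ.- s) ℤ.* + suc k)
          * pow (u p q (m ℤ.- r)) (suc k) * w p q a b (n ℤ.- (m ℤ.- s) ℤ.* + suc k))
     ×
     -- (3)
     ((u p q (r ℤ.- s) * w p q a b n * w p q a b (n ℤ.- (r ℤ.- s) ℤ.* + suc k))
        * sumTo k (λ j →
            zpow q ((r ℤ.- s) ℤ.* + j)
              * pow (u p q (m ℤ.- s)) (k ∸ j) * pow (u p q (m ℤ.- r)) j
              * w p q a b (n ℤ.+ m ℤ.- r ℤ.- (r ℤ.- s) ℤ.* + k ℤ.+ (r ℤ.- s) ℤ.* + j)
            / (w p q a b (n ℤ.- (r ℤ.- s) ℤ.* + k ℤ.+ (r ℤ.- s) ℤ.* + j)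
               * w p q a b (n ℤ.- (r ℤ.- s) ℤ.- (r ℤ.- s) ℤ.* + k ℤ.+ (r ℤ.- s) ℤ.* + j)))
      ≈ pow (u p q (m ℤ.- s)) (suc k) * w p q a b n
        - zpow q ((r ℤ.- s) ℤ.* + suc k)
          * pow (u p q (m ℤ.- r)) (suc k) * w p q a b (n ℤ.- (r ℤ.- s) ℤ.* + suc k))
     ×
     -- (4)
     (- (zpow q (r ℤ.- s) * u p q (m ℤ.+ s) * w p q a b n * w p q a b (n ℤ.- (m ℤ.+ s) ℤ.* + suc k))
        * sumTo k (λ j →
            pow (u p q (r ℤ.- s)) (k ∸ j) * pow (u p q (m ℤ.+ r)) j
              * w p q a b (n ℤ.- m ℤ.- r ℤ.- (m ℤ.+ s) ℤ.* + k ℤ.+ (m ℤ.+ s) ℤ.* + j)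
            / (w p q a b (n ℤ.- (m ℤ.+ s) ℤ.* + k ℤ.+ (m ℤ.+ s) ℤ.* + j)
               * w p q a b (n ℤ.- (m ℤ.+ s) ℤ.- (m ℤ.+ s) ℤ.* + k ℤ.+ (m ℤ.+ s) ℤ.* + j)))
      ≈ pow (u p q (r ℤ.- s)) (suc k) * w p q a b n
        - pow (u p q (m ℤ.+ r)) (suc k) * w p q a b (n ℤ.- (m ℤ.+ s) ℤ.* + suc k))
     ×
     -- (5)
     ((u p q (m ℤ.+ r) * w p q a b n * w p q a b (n ℤ.- (m ℤ.+ r) ℤ.* + suc k))
        * sumTo k (λ j →
            pow (- 1#) j * zpow q ((r ℤ.- s) ℤ.* + j)
              * pow (u p q (r ℤ.- s)) (k ∸ j) * pow (u p q (m ℤ.+ s)) j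
              * w p q a b (n ℤ.- (m ℤ.+ s) ℤ.- (m ℤ.+ r) ℤ.* + k ℤ.+ (m ℤ.+ r) ℤ.* + j)
            / (w p q a b (n ℤ.- (m ℤ.+ r) ℤ.* + k ℤ.+ (m ℤ.+ r) ℤ.* + j)
               * w p q a b (n ℤ.- (m ℤ.+ r) ℤ.- (m ℤ.+ r) ℤ.* + k ℤ.+ (m ℤ.+ r) ℤ.* + j)))
      ≈ pow (u p q (r ℤ.- s)) (suc k) * w p q a b n
        - pow (- 1#) (suc k) * zpow q ((r ℤ.- s) ℤ.* + suc k)
          * pow (u p q (m ℤ.+ s)) (suc k) * w p q a b (n ℤ.- (m ℤ.+ r) ℤ.* + suc k))
     ×
     -- (6)
     ((u p q (r ℤ.- s) * w p q a b n * w p q a b (n ℤ.- (r ℤ.- s) ℤ.* + suc k))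
        * sumTo k (λ j →
            zpow q ((r ℤ.- s) ℤ.* + j)
              * pow (u p q (m ℤ.+ r)) (k ∸ j) * pow (u p q (m ℤ.+ s)) j
              * w p q a b (n ℤ.+ m ℤ.+ s ℤ.- (r ℤ.- s) ℤ.* + k ℤ.+ (r ℤ.- s) ℤ.* + j)
            / (w p q a b (n ℤ.- (r ℤ.- s) ℤ.* + k ℤ.+ (r ℤ.- s) ℤ.* + j)
               * w p q a b (n ℤ.- (r ℤ.- s) ℤ.- (r ℤ.- s) ℤ.* + k ℤ.+ (r ℤ.- s) ℤ.* + j)))
      ≈ pow (u p q (m ℤ.+ r)) (suc k) * w p q a b n
        - zpow q ((r ℤ.- s) ℤ.* + suc k)
          * pow (u p q (m ℤ.+ s)) (suc k) * w p q a b (n ℤ.- (r ℤ.- s) ℤ.* + suc k))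
-- Each identity is one of the three shapes; the denominator hypotheses
-- come in pairs, one pair for each step size d.
mainTheorem8 F p q a b _ q≉0 r s m n k nonzero =
    shape-I a b (r ℤ.- s) (m ℤ.- s) (m ℤ.- r) (m ℤ.- r) n k _
      (λ j j≤k → let (N , M , _) = nonzero j j≤k in N , M)
      (u-indices-minus m r s) (λ j → indices-1-upper n m r s (+ k) (+ j)) (λ j → indices-1-lower n m r s (+ k) (+ j))
  , shape-II a b (r ℤ.- s) (m ℤ.- s) (m ℤ.- r) n k _
      (λ j j≤k → let (_ , _ , N , M , _) = nonzero j j≤k in N , M)
      (u-indices-minus m r s) (λ j → indices-2 n m r s (+ k) (+ j))
  , shape-III a b (r ℤ.- s) (m ℤ.- s) (m ℤ.- r) n k _
      (λ j j≤k → let (_ , _ , _ , _ , N , M , _) = nonzero j j≤k in N , M)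
      (u-indices-minus m r s) (λ j → indices-3 n m r s (+ k) (+ j))
  , shape-I a b (r ℤ.- s) (m ℤ.+ r) (m ℤ.+ s) (m ℤ.+ s) n k _
      (λ j j≤k → let (_ , _ , _ , _ , _ , _ , N , M , _) = nonzero j j≤k in N , M)
      (u-indices-plus m r s) (λ j → indices-4-upper n m r s (+ k) (+ j)) (λ j → indices-4-lower n m r s (+ k) (+ j))
  , shape-II a b (r ℤ.- s) (m ℤ.+ r) (m ℤ.+ s) n k _
      (λ j j≤k → let (_ , _ , _ , _ , _ , _ , _ , _ , N , M) = nonzero j j≤k in N , M)
      (u-indices-plus m r s) (λ j → indices-5 n m r s (+ k) (+ j))
  , shape-III a b (r ℤ.- s) (m ℤ.+ r) (m ℤ.+ s) n k _
      (λ j j≤k → let (_ , _ , _ , _ , N , M , _) = nonzero j j≤k in N , M)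
      (u-indices-plus m r s) (λ j → indices-6 n m r s (+ k) (+ j))
  where open HoradamIdentities F p q q≉0
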